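{- Let $(X,S)$ be an association scheme of order $n$ and $H$ a Hadamard matrix whose rows and columns are indexed by the elements of $X$. Write $x_{ab}$ for $(x,a,b)\in X\times\mathbb{F}_2\times\mathbb{F}_2$, and let $(\widetilde{X}, S(H))$ be the association scheme with $\widetilde{X}=\{x_{ab}\mid x\in X,\ a,b\in\mathbb{F}_2\}$, $\widetilde{t}=\{(x_{ab},x_{a(b+1)})\mid x\in X,\ a,b\in\mathbb{F}_2\}$, $\widetilde{s}=\{(x_{ab},y_{ac})\mid (x,y)\in s,\ a,b,c\in\mathbb{F}_2\}$ for $s\in S\setminus\{1_X\}$, $r^{1}_H=\{(x_{ab},y_{cd})\mid x,y\in X,\ a,b,c,d\in\mathbb{F}_2,\ (1-\delta_{ac})(H^{T(a)})_{xy}=(-1)^{b+d}\}$, $r^{ -1}_H=\{(x_{ab},y_{cd})\mid x,y\in X,\ a,b,c,d\in\mathbb{F}_2,\ a\neq c\}\setminus r^{1}_H$, $S(H)=\{1_{\widetilde{X}},\widetilde{t}\}\cup\{\widetilde{s}\mid s\in S\setminus\{1_X\}\}\cup\{r^{1}_H,r^{ -1}_H\}$, where $\delta_{ac}=1$ if $a=c$ and $0$ otherwise, $H^{T(0)}=H$ and $H^{T(1)}=H^T$; for any Hadamard matrix $H'$ indexed by $X$, $S(H')$ is defined in the same way with $H'$ in place of $H$. For a bijection $\phi$ of $\widetilde{X}$ and $h\in S(H)$ put $\phi(h):=\{(\phi(x),\phi(y))\mid (x,y)\in h\}$. For $y\in X$ let $D_y$ be the diagonal matrix whose $(y,y)$-entry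 is $-1$ and whose other diagonal entries are $1$, and put $H_1=D_yH$ and $H_2=HD_y$. Then: (i) $\phi: x_{ab}\mapsto x_{(a+1)b},\ h\mapsto\phi(h)$ is an isomorphism from $\widetilde{X}\cup S(H)$ to $\widetilde{X}\cup S(H^T)$; (ii) for $y\in X$, the transposition $\alpha_y=(y_{ab}\ y_{a(b+a+1)})\in Sym(\widetilde{X})$ induces an isomorphism $\phi$ from $\widetilde{X}\cup S(H)$ to $\widetilde{X}\cup S(H_1)$ defined by $\phi|_{\widetilde{X}}=\alpha_y$, $\phi|_{S(H)}: h\mapsto\phi(h)$; (iii) for $y\in X$, the transposition $\beta_y=(y_{ab}\ y_{a(b+a)})\in Sym(\widetilde{X})$ induces an isomorphism $\phi$ from $\widetilde{X}\cup S(H)$ to $\widetilde{X}\cup S(H_2)$ defined by $\phi|_{\widetilde{X}}=\beta_y$, $\phi|_{S(H)}: h\mapsto\phi(h)$; (iv) $\phi: x_{ab}\mapsto x_{a(b+a+1)},\ h\mapsto\phi(h)$ is an isomorphism from $\widetilde{X}\cup S(H)$ to $\widetilde{X}\cup S(-H)$; (v) $\phi: x_{ab}\mapsto x_{a(b+a)},\ h\mapsto\phi(h)$ is an isomorphism from $\widetilde{X}\cup S(H)$ to $\widetilde{X}\cup S(-H)$.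
   Context: An isomorphism from an association scheme $(X,S)$ to $(X_1,S_1)$ is a bijection $\phi: X\cup S\to X_1\cup S_1$ with $\phi(X)\subseteq X_1$, $\phi(S)\subseteq S_1$, and $(\phi(x),\phi(y))\in\phi(s)$ whenever $(x,y)\in s$. It is known (Theorem 1.1 of the paper) that $(\widetilde{X},S(H))$ is an association scheme for every Hadamard matrix $H$ indexed by $X$; $(\widetilde{X}, r^1_H)$ is the Hadamard graph of $H$. -}

module Defs where

open import Data.Nat using (ℕ; zero; suc)
open import Data.Fin using (Fin; zero; suc; _≟_)
open import Data.Bool using (Bool; true; false; not; _xor_; if_then_else_; T)
open import Data.Integer using (ℤ; +_; -_; _+_; _*_; _-_; 1ℤ; 0ℤ; -1ℤ)
open import Data.List using (List; length; filter)
open import Data.Fin.Base using ()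
open import Data.List using (allFin)
open import Data.Product using (Σ; ∃; _×_; _,_)
open import Data.Sum using (_⊎_)
open import Data.Unit using (⊤)
open import Relation.Nullary using (¬_; does)
open import Relation.Nullary.Decidable using (_×-dec_)
open import Relation.Binary.PropositionalEquality using (_≡_; _≢_)
open import Function.Definitions using (Bijective)

-- The partition S of X × X is encoded by the map σ : X → X → Fin d
-- sending (x,y) to the (label of the) unique relation containing it;
-- the relation with label l is { (x,y) | σ x y ≡ l }.

_⇔_ : Set → Set → Set
A ⇔ B = (A → B) × (B → A)

interCount : ∀ {n d} → (Fin n → Fin n → Fin d) → Fin d → Fin d → Fin n → Fin n → ℕ
interCount {n} σ l m x y =
  length (filter (λ z → (σ x z ≟ l) ×-dec (σ z y ≟ m)) (allFin n))

record AssocScheme (n d : ℕ) : Set where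
  field
    σ        : Fin n → Fin n → Fin d
    nonempty : ∀ l → ∃ λ x → ∃ λ y → σ x y ≡ l
    one      : Fin d
    one-spec : ∀ x y → (σ x y ≡ one) ⇔ (x ≡ y)
    transp   : ∀ l → ∃ λ l* → ∀ x y → (σ x y ≡ l) ⇔ (σ y x ≡ l*)
    inter    : ∀ l m k → ∃ λ p → ∀ x y → σ x y ≡ k → interCount σ l m x y ≡ p

Matrix : ℕ → Set
Matrix n = Fin n → Fin n → ℤ

∑ : ∀ {n} → (Fin n → ℤ) → ℤ
∑ {zero}  f = 0ℤ
∑ {suc n} f = f zero + ∑ (λ i → f (suc i))

δℤ : ∀ {n} → Fin n → Fin n → ℤ
δℤ x y = if does (x ≟ y) then 1ℤ else 0ℤ

IsHadamard : ∀ {n} → Matrix n → Set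
IsHadamard {n} H =
  (∀ x y → (H x y ≡ 1ℤ) ⊎ (H x y ≡ -1ℤ)) ×
  (∀ x y → ∑ (λ z → H x z * H y z) ≡ (+ n) * δℤ x y)

transpose : ∀ {n} → Matrix n → Matrix n
transpose H x y = H y x

neg : ∀ {n} → Matrix n → Matrix n
neg H x y = - H x y

-- D_y H  and  H D_y, where D_y = diag with -1 at (y,y), 1 elsewhere
DH : ∀ {n} → Fin n → Matrix n → Matrix n
DH y H x z = if does (x ≟ y) then - H x z else H x z

HD : ∀ {n} → Fin n → Matrix n → Matrix n
HD y H x z = if does (z ≟ y) then - H x z else H x z

-- F₂ is represented by Bool (false = 0, true = 1, addition = xor)

F₂ : Set
F₂ = Bool

HT : ∀ {n} → F₂ → Matrix n → Matrix n
HT false H = H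
HT true  H = transpose H

δ₂ : F₂ → F₂ → ℤ
δ₂ false false = 1ℤ
δ₂ true  true  = 1ℤ
δ₂ _     _     = 0ℤ

sgn : F₂ → ℤ
sgn false = 1ℤ
sgn true  = -1ℤ

X̃ : ℕ → Set
X̃ n = Fin n × F₂ × F₂

-- labels of the relations of S(H):
-- 1_{X̃}, t̃, s̃ for s ∈ S \ {1_X}, r¹_H, r⁻¹_H
data SLabel {n d : ℕ} (S : AssocScheme n d) : Set where
  one   : SLabel S
  t     : SLabel S
  tilde : (s : Fin d) → T (not (does (s ≟ AssocScheme.one S))) → SLabel S
  r⁺    : SLabel S
  r⁻    : SLabel S

BinRel : ℕ → Set₁
BinRel n = X̃ n → X̃ n → Set

r1 : ∀ {n} → Matrix n → BinRel n
r1 M (x , a , b) (y , c , d) = (1ℤ - δ₂ a c) * HT a M x y ≡ sgn (b xor d)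

SRel : ∀ {n d} (S : AssocScheme n d) → Matrix n → SLabel S → BinRel n
SRel S M one u v = u ≡ v
SRel S M t (x , a , b) (y , c , d) = (x ≡ y) × (a ≡ c) × (d ≡ not b)
SRel S M (tilde s _) (x , a , b) (y , c , d) = (AssocScheme.σ S x y ≡ s) × (a ≡ c)
SRel S M r⁺ u v = r1 M u v
SRel S M r⁻ (x , a , b) (y , c , d) = (a ≢ c) × ¬ r1 M (x , a , b) (y , c , d)

image : ∀ {n} → (X̃ n → X̃ n) → BinRel n → BinRel n
image f R u v = ∃ λ p → ∃ λ q → (f p ≡ u) × (f q ≡ v) × R p q

_≐_ : ∀ {n} → BinRel n → BinRel n → Set
R ≐ R' = ∀ u v → R u v ⇔ R' u v

InducedIso : ∀ {n d} (S : AssocScheme n d) → Matrix n → Matrix n → (X̃ n → X̃ n) → Set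
InducedIso S M M' f =
  Bijective _≡_ _≡_ f ×
  Σ (SLabel S → SLabel S) λ g →
    Bijective _≡_ _≡_ g ×
    (∀ h → image f (SRel S M h) ≐ SRel S M' (g h)) ×
    (∀ h u v → SRel S M h u v → SRel S M' (g h) (f u) (f v))

φ₁ : ∀ {n} → X̃ n → X̃ n
φ₁ (x , a , b) = (x , not a , b)

α : ∀ {n} → Fin n → X̃ n → X̃ n
α y (x , a , b) = if does (x ≟ y) then (x , a , (b xor a) xor true) else (x , a , b)

β : ∀ {n} → Fin n → X̃ n → X̃ n
β y (x , a , b) = if does (x ≟ y) then (x , a , b xor a) else (x , a , b)

φ₄ : ∀ {n} → X̃ n → X̃ n
φ₄ (x , a , b) = (x , a , (b xor a) xor true)

φ₅ : ∀ {n} → X̃ n → X̃ n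
φ₅ (x , a , b) = (x , a , b xor a)

module Submission where

open import Defs
open import Data.Fin using (Fin; _≟_)
open import Data.Product using (_×_; _,_; proj₁; proj₂; map₂)
open import Data.Bool using (true; false; not; _xor_; if_then_else_)
open import Data.Bool.Properties as Bool
  using (xor-comm; not-involutive; not-injective; not-distribʳ-xor; ¬-not; xor-∧-commutativeRing)
open import Data.Integer using (ℤ; -_; 0ℤ)
open import Data.Integer.Properties using (neg-injective; *-identityˡ)
open import Data.Empty using (⊥-elim)
open import Relation.Nullary using (¬_; does; yes; no)
open import Relation.Binary.PropositionalEquality
open import Function.Base using (id)
open import Function.Consequences.Propositional
  using (inverseᵇ⇒bijective; strictlyInverseˡ⇒inverseˡ; strictlyInverseʳ⇒inverseʳ)
import Function.Construct.Identity as Identity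
open import Algebra.Bundles using (CommutativeRing)
open import Algebra.Properties.CommutativeSemigroup
  (CommutativeRing.+-commutativeSemigroup xor-∧-commutativeRing)
  using () renaming (interchange to xor-interchange)

-- Every map in the theorem is a shear  x_ab ↦ x_(s+a)(e(x,a)+b).  It keeps the point of X and
-- translates the coordinate a, so it preserves 1, t̃ and every s̃.  On a pair x_ab, y_cd with
-- a ≠ c it multiplies (-1)^(b+d) by (-1)^(e(x,a)+e(y,c)), and in each case the new matrix H' is
-- H with its entries re-signed by exactly that factor; so r¹_H goes to r¹_H', and r⁻¹_H, the
-- rest of the pairs with a ≠ c, goes to r⁻¹_H'.

flipSign : F₂ → ℤ → ℤ
flipSign false z = z
flipSign true  z = - z

flipSign-injective : ∀ e {z w} → flipSign e z ≡ flipSign e w → z ≡ w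
flipSign-injective false = id
flipSign-injective true  = neg-injective

sgn-xor : ∀ e b → sgn (e xor b) ≡ flipSign e (sgn b)
sgn-xor false b     = refl
sgn-xor true  false = refl
sgn-xor true  true  = refl

0ℤ≢sgn : ∀ b → 0ℤ ≢ sgn b
0ℤ≢sgn false ()
0ℤ≢sgn true  ()

xor-selfInverseˡ : ∀ s a → s xor (s xor a) ≡ a
xor-selfInverseˡ false a = refl
xor-selfInverseˡ true  a = not-involutive a

xor-cancelˡ : ∀ s {a c} → s xor a ≡ s xor c → a ≡ c
xor-cancelˡ false = id
xor-cancelˡ true  = not-injective

xor-true-comm : ∀ b a → (b xor a) xor true ≡ not a xor b
xor-true-comm false false = refl
xor-true-comm false true  = refl
xor-true-comm true  false = refl
xor-true-comm true  true  = refl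

r1-diagonal : ∀ {n} (M : Matrix n) x a b y d → ¬ r1 M (x , a , b) (y , a , d)
r1-diagonal M x false b y d = 0ℤ≢sgn (b xor d)
r1-diagonal M x true  b y d = 0ℤ≢sgn (b xor d)

r1-offdiagonal : ∀ {n} (M : Matrix n) x a b y d →
  r1 M (x , a , b) (y , not a , d) ⇔ (HT a M x y ≡ sgn (b xor d))
r1-offdiagonal M x false b y d = trans (sym (*-identityˡ _)) , trans (*-identityˡ _)
r1-offdiagonal M x true  b y d = trans (sym (*-identityˡ _)) , trans (*-identityˡ _)

shear : ∀ {n} → F₂ → (Fin n → F₂ → F₂) → X̃ n → X̃ n
shear s e (x , a , b) = x , s xor a , e x a xor b

unshear : ∀ {n} → F₂ → (Fin n → F₂ → F₂) → X̃ n → X̃ n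
unshear s e (x , a , b) = x , s xor a , e x (s xor a) xor b

unshear-shear : ∀ {n} s (e : Fin n → F₂ → F₂) u → unshear s e (shear s e u) ≡ u
unshear-shear s e (x , a , b)
  rewrite xor-selfInverseˡ s a | xor-selfInverseˡ (e x a) b = refl

shear-unshear : ∀ {n} s (e : Fin n → F₂ → F₂) u → shear s e (unshear s e u) ≡ u
shear-unshear s e (x , a , b)
  rewrite xor-selfInverseˡ s a | xor-selfInverseˡ (e x (s xor a)) b = refl

shear-injective : ∀ {n} s (e : Fin n → F₂ → F₂) {u v} → shear s e u ≡ shear s e v → u ≡ v
shear-injective s e {u} {v} eq =
  trans (sym (unshear-shear s e u)) (trans (cong (unshear s e) eq) (unshear-shear s e v))

-- Only the sign e y (not a) of the other layer occurs, since r¹ only relates x_ab to y_cd with c ≠ a.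
ReSigns : ∀ {n} → Matrix n → Matrix n → F₂ → (Fin n → F₂ → F₂) → Set
ReSigns M M' s e = ∀ x y a → HT (s xor a) M' x y ≡ flipSign (e x a xor e y (not a)) (HT a M x y)

module _ {n d} (S : AssocScheme n d) (M M' : Matrix n) (s : F₂) (e : Fin n → F₂ → F₂)
         (signs : ReSigns M M' s e) where

  entry-shear : ∀ x y a b d →
    (HT a M x y ≡ sgn (b xor d)) ⇔
    (HT (s xor a) M' x y ≡ sgn ((e x a xor b) xor (e y (not a) xor d)))
  entry-shear x y a b d =
    (λ p → trans (signs x y a) (trans (cong (flipSign ε) p) (sym sgn-sheared))) ,
    (λ q → flipSign-injective ε (trans (sym (signs x y a)) (trans q sgn-sheared)))
    where
    ε : F₂
    ε = e x a xor e y (not a)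
    sgn-sheared : sgn ((e x a xor b) xor (e y (not a) xor d)) ≡ flipSign ε (sgn (b xor d))
    sgn-sheared = trans (cong sgn (xor-interchange (e x a) b (e y (not a)) d)) (sgn-xor ε (b xor d))

  r1-shear : ∀ x a b y c d →
    r1 M (x , a , b) (y , c , d) ⇔ r1 M' (shear s e (x , a , b)) (shear s e (y , c , d))
  r1-shear x a b y c d with c Bool.≟ a
  ... | yes refl =
    (λ r → ⊥-elim (r1-diagonal M x a b y d r)) ,
    (λ r → ⊥-elim (r1-diagonal M' x (s xor a) (e x a xor b) y (e y a xor d) r))
  ... | no c≢a with refl ← ¬-not c≢a rewrite sym (not-distribʳ-xor s a) =
    (λ r → proj₂ offdiagonal' (proj₁ (entry-shear x y a b d) (proj₁ offdiagonal r))) ,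
    (λ r → proj₂ offdiagonal (proj₂ (entry-shear x y a b d) (proj₁ offdiagonal' r)))
    where
    offdiagonal : r1 M (x , a , b) (y , not a , d) ⇔ (HT a M x y ≡ sgn (b xor d))
    offdiagonal = r1-offdiagonal M x a b y d
    offdiagonal' : r1 M' (x , s xor a , e x a xor b) (y , not (s xor a) , e y (not a) xor d) ⇔
                   (HT (s xor a) M' x y ≡ sgn ((e x a xor b) xor (e y (not a) xor d)))
    offdiagonal' = r1-offdiagonal M' x (s xor a) (e x a xor b) y (e y (not a) xor d)

  ≢-shear : ∀ a c → (a ≢ c) ⇔ (s xor a ≢ s xor c)
  ≢-shear a c = (λ a≢c eq → a≢c (xor-cancelˡ s eq)) , (λ a≢c eq → a≢c (cong (s xor_) eq))

  shear-preserves : ∀ h u v → SRel S M h u v ⇔ SRel S M' h (shear s e u) (shear s e v)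
  shear-preserves one u v = cong (shear s e) , shear-injective s e
  shear-preserves t (x , a , b) (y , c , d) = forward , backward
    where
    forward : SRel S M t (x , a , b) (y , c , d) →
              SRel S M' t (shear s e (x , a , b)) (shear s e (y , c , d))
    forward (refl , refl , refl) = refl , refl , sym (not-distribʳ-xor (e x a) b)
    backward : SRel S M' t (shear s e (x , a , b)) (shear s e (y , c , d)) →
               SRel S M t (x , a , b) (y , c , d)
    backward (refl , q , r) with refl ← xor-cancelˡ s q =
      refl , refl , xor-cancelˡ (e x a) (trans r (not-distribʳ-xor (e x a) b))
  shear-preserves (tilde _ _) (x , a , b) (y , c , d) =
    map₂ (cong (s xor_)) , map₂ (xor-cancelˡ s)
  shear-preserves r⁺ (x , a , b) (y , c , d) = r1-shear x a b y c d
  shear-preserves r⁻ (x , a , b) (y , c , d) =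
    (λ { (a≢c , ¬r) → proj₁ (≢-shear a c) a≢c , (λ r → ¬r (proj₂ (r1-shear x a b y c d) r)) }) ,
    (λ { (a≢c , ¬r) → proj₂ (≢-shear a c) a≢c , (λ r → ¬r (proj₁ (r1-shear x a b y c d) r)) })

inducedIso-fromInverse : ∀ {n d} (S : AssocScheme n d) {M M' : Matrix n} (f g : X̃ n → X̃ n) →
  (∀ u → f (g u) ≡ u) → (∀ u → g (f u) ≡ u) →
  (∀ h u v → SRel S M h u v ⇔ SRel S M' h (f u) (f v)) → InducedIso S M M' f
inducedIso-fromInverse S {M} {M'} f g fg gf pres =
  inverseᵇ⇒bijective (strictlyInverseˡ⇒inverseˡ f fg , strictlyInverseʳ⇒inverseʳ f gf) ,
  id , Identity.bijective _≡_ , image-eq , (λ h u v → proj₁ (pres h u v))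
  where
  image-eq : ∀ h → image f (SRel S M h) ≐ SRel S M' h
  image-eq h u v =
    (λ { (p , q , refl , refl , r) → proj₁ (pres h p q) r }) ,
    (λ r → g u , g v , fg u , fg v ,
      proj₂ (pres h (g u) (g v)) (subst₂ (SRel S M' h) (sym (fg u)) (sym (fg v)) r))

shear-inducedIso : ∀ {n d} (S : AssocScheme n d) {M M' : Matrix n} s e {f : X̃ n → X̃ n} →
  f ≗ shear s e → ReSigns M M' s e → InducedIso S M M' f
shear-inducedIso S {M} {M'} s e {f} f≗ signs =
  inducedIso-fromInverse S f (unshear s e)
    (λ u → trans (f≗ (unshear s e u)) (shear-unshear s e u))
    (λ u → trans (cong (unshear s e) (f≗ u)) (unshear-shear s e u))
    preserves
  where
  preserves : ∀ h u v → SRel S M h u v ⇔ SRel S M' h (f u) (f v)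
  preserves h u v rewrite f≗ u | f≗ v = shear-preserves S M M' s e signs h u v

atPoint : ∀ {n} → Fin n → (F₂ → F₂) → Fin n → F₂ → F₂
atPoint y g x a = if does (x ≟ y) then g a else false

φ₁-shear : ∀ {n} → φ₁ {n} ≗ shear true (λ _ _ → false)
φ₁-shear _ = refl

α-shear : ∀ {n} (y : Fin n) → α y ≗ shear false (atPoint y not)
α-shear y (x , a , b) with does (x ≟ y)
... | true  = cong (λ c → x , a , c) (xor-true-comm b a)
... | false = refl

β-shear : ∀ {n} (y : Fin n) → β y ≗ shear false (atPoint y id)
β-shear y (x , a , b) with does (x ≟ y)
... | true  = cong (λ c → x , a , c) (xor-comm b a)
... | false = refl

φ₄-shear : ∀ {n} → φ₄ {n} ≗ shear false (λ _ → not)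
φ₄-shear (x , a , b) = cong (λ c → x , a , c) (xor-true-comm b a)

φ₅-shear : ∀ {n} → φ₅ {n} ≗ shear false (λ _ → id)
φ₅-shear (x , a , b) = cong (λ c → x , a , c) (xor-comm b a)

transpose-reSigns : ∀ {n} (H : Matrix n) → ReSigns H (transpose H) true (λ _ _ → false)
transpose-reSigns H x y false = refl
transpose-reSigns H x y true  = refl

DH-reSigns : ∀ {n} (H : Matrix n) y → ReSigns H (DH y H) false (atPoint y not)
DH-reSigns H y x z false with x ≟ y | z ≟ y
... | yes _ | yes _ = refl
... | yes _ | no _  = refl
... | no _  | yes _ = refl
... | no _  | no _  = refl
DH-reSigns H y x z true with x ≟ y | z ≟ y
... | yes _ | yes _ = refl
... | yes _ | no _  = refl
... | no _  | yes _ = refl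
... | no _  | no _  = refl

HD-reSigns : ∀ {n} (H : Matrix n) y → ReSigns H (HD y H) false (atPoint y id)
HD-reSigns H y x z false with x ≟ y | z ≟ y
... | yes _ | yes _ = refl
... | yes _ | no _  = refl
... | no _  | yes _ = refl
... | no _  | no _  = refl
HD-reSigns H y x z true with x ≟ y | z ≟ y
... | yes _ | yes _ = refl
... | yes _ | no _  = refl
... | no _  | yes _ = refl
... | no _  | no _  = refl

neg-reSigns-not : ∀ {n} (H : Matrix n) → ReSigns H (neg H) false (λ _ → not)
neg-reSigns-not H x y false = refl
neg-reSigns-not H x y true  = refl

neg-reSigns-id : ∀ {n} (H : Matrix n) → ReSigns H (neg H) false (λ _ → id)
neg-reSigns-id H x y false = refl
neg-reSigns-id H x y true  = refl

lemma3p1 : ∀ {n d} (S : AssocScheme n d) (H : Matrix n) → IsHadamard H →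
    InducedIso S H (transpose H) φ₁ ×
    (∀ (y : Fin n) → InducedIso S H (DH y H) (α y)) ×
    (∀ (y : Fin n) → InducedIso S H (HD y H) (β y)) ×
    InducedIso S H (neg H) φ₄ ×
    InducedIso S H (neg H) φ₅
lemma3p1 S H _ =
  shear-inducedIso S true (λ _ _ → false) φ₁-shear (transpose-reSigns H) ,
  (λ y → shear-inducedIso S false (atPoint y not) (α-shear y) (DH-reSigns H y)) ,
  (λ y → shear-inducedIso S false (atPoint y id) (β-shear y) (HD-reSigns H y)) ,
  shear-inducedIso S false (λ _ → not) φ₄-shear (neg-reSigns-not H) ,
  shear-inducedIso S false (λ _ → id) φ₅-shear (neg-reSigns-id H)
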